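{- Let $G$ be a graph with a cut vertex $z$ such that $G\setminus z$ has a connected component $Q$ which is a complete graph and such that $z$ is adjacent to every vertex of $Q$. Then $G$ is an OAT graph if and only if $G\setminus Q$ is an OAT graph.
   Context: All graphs are finite and simple; a cut vertex is a vertex whose deletion increases the number of components; $G\setminus X$ denotes deletion of the vertices of $X$. For non-adjacent vertices $u,v$, $u$ is comparable to $v$ if $N(u)\subseteq N(v)$. A graph is an OAT graph if it can be constructed from single-vertex graphs by a finite sequence of the following operations, where $G_1=(V_1,E_1)$, $G_2=(V_2,E_2)$ are vertex-disjoint OAT graphs: (1) disjoint union $(V_1\cup V_2,E_1\cup E_2)$; (2) join $(V_1\cup V_2, E_1\cup E_2\cup\{xy: x\in V_1,y\in V_2\})$; (3) adding a comparable vertex: for $v\in V_1$ and a new vertex $u\notin V_1$, form $(V_1\cup\{u\}, E_1\cup\{ux: x\in X\})$ for some $X\subseteq N(v)$; (4) attaching a clique: for a complete graph $Q=(V_Q,E_Q)$ disjoint from $G_1$ and $v\in V_1$, form $(V_1\cup V_Q, E_1\cup E_Q\cup\{qv: q\in V_Q\})$. -}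

module Defs where

open import Data.Nat using (ℕ; _<_)
open import Data.Bool using (Bool; true; false; not; T)
open import Data.Unit using (⊤; tt)
open import Data.Sum using (_⊎_; inj₁; inj₂)
open import Data.Maybe using (Maybe; just; nothing)
open import Data.Fin using (Fin)
import Data.Fin as F
open import Data.Product using (Σ; _×_; _,_; proj₁; proj₂; ∃; ∃-syntax)
import Relation.Binary.PropositionalEquality as Eq
open import Relation.Binary.PropositionalEquality using (_≡_; refl; _≢_)
open import Relation.Binary.Definitions using (DecidableEquality)
open import Relation.Nullary using (yes; no; ¬_)
open import Relation.Nullary.Decidable using (⌊_⌋)
open import Function.Bundles using (_↔_; Inverse; _⇔_)
open import Function.Definitions using (Surjective)

-- Finite simple graphs: a vertex type with a Bool-valued symmetric,
-- irreflexive adjacency relation.  (Finiteness is imposed where needed.)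

record Graph : Set₁ where
  field
    V      : Set
    adj    : V → V → Bool
    adj-sym : ∀ u v → adj u v ≡ adj v u
    adj-irrefl : ∀ v → adj v v ≡ false
open Graph public

Finite : Set → Set
Finite A = ∃[ n ] (Fin n ↔ A)

record _≅_ (G H : Graph) : Set where
  field
    bij : V G ↔ V H
    pres : ∀ u v → adj H (Inverse.to bij u) (Inverse.to bij v) ≡ adj G u v

induced : (G : Graph) → (V G → Bool) → Graph
induced G p = record
  { V = Σ (V G) (λ v → T (p v))
  ; adj = λ u w → adj G (proj₁ u) (proj₁ w)
  ; adj-sym = λ u w → adj-sym G (proj₁ u) (proj₁ w)
  ; adj-irrefl = λ u → adj-irrefl G (proj₁ u)
  }

delVertex : (G : Graph) → DecidableEquality (V G) → V G → Graph
delVertex G _≟_ z = induced G (λ v → not ⌊ v ≟ z ⌋)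

delSet : (G : Graph) → (V G → Bool) → Graph
delSet G X = induced G (λ v → not (X v))

data Reach (G : Graph) (u : V G) : V G → Set where
  here : Reach G u u
  step : ∀ {w x} → Reach G u w → T (adj G w x) → Reach G u x

-- G has exactly k connected components: there is a surjective labelling
-- of the vertices by Fin k whose fibres are exactly the components.
NumComponents : Graph → ℕ → Set
NumComponents G k =
  Σ (V G → Fin k) λ c → Surjective _≡_ _≡_ c ×
    (∀ u w → (c u ≡ c w → Reach G u w) × (Reach G u w → c u ≡ c w))

IsCutVertex : (G : Graph) → DecidableEquality (V G) → V G → Set
IsCutVertex G _≟_ z =
  ∃[ k ] ∃[ k' ] (NumComponents G k × NumComponents (delVertex G _≟_ z) k' × k < k')

K1 : Graph
K1 = record { V = ⊤ ; adj = λ _ _ → false ; adj-sym = λ _ _ → refl ; adj-irrefl = λ _ → refl }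

private
  uAdj : (G H : Graph) → Bool → V G ⊎ V H → V G ⊎ V H → Bool
  uAdj G H b (inj₁ x) (inj₁ y) = adj G x y
  uAdj G H b (inj₂ x) (inj₂ y) = adj H x y
  uAdj G H b (inj₁ x) (inj₂ y) = b
  uAdj G H b (inj₂ x) (inj₁ y) = b

  uSym : ∀ G H b u v → uAdj G H b u v ≡ uAdj G H b v u
  uSym G H b (inj₁ x) (inj₁ y) = adj-sym G x y
  uSym G H b (inj₂ x) (inj₂ y) = adj-sym H x y
  uSym G H b (inj₁ x) (inj₂ y) = refl
  uSym G H b (inj₂ x) (inj₁ y) = refl

  uIrr : ∀ G H b v → uAdj G H b v v ≡ false
  uIrr G H b (inj₁ x) = adj-irrefl G x
  uIrr G H b (inj₂ x) = adj-irrefl H x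

_⊕_ : Graph → Graph → Graph
G ⊕ H = record { V = V G ⊎ V H ; adj = uAdj G H false ; adj-sym = uSym G H false ; adj-irrefl = uIrr G H false }

_⊗_ : Graph → Graph → Graph
G ⊗ H = record { V = V G ⊎ V H ; adj = uAdj G H true ; adj-sym = uSym G H true ; adj-irrefl = uIrr G H true }

private
  cAdj : (G : Graph) → (V G → Bool) → Maybe (V G) → Maybe (V G) → Bool
  cAdj G X nothing nothing = false
  cAdj G X nothing (just y) = X y
  cAdj G X (just x) nothing = X x
  cAdj G X (just x) (just y) = adj G x y

  cSym : ∀ G X u v → cAdj G X u v ≡ cAdj G X v u
  cSym G X nothing nothing = refl
  cSym G X nothing (just y) = refl
  cSym G X (just x) nothing = refl
  cSym G X (just x) (just y) = adj-sym G x y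

  cIrr : ∀ G X v → cAdj G X v v ≡ false
  cIrr G X nothing = refl
  cIrr G X (just x) = adj-irrefl G x

addVertex : (G : Graph) → (V G → Bool) → Graph
addVertex G X = record { V = Maybe (V G) ; adj = cAdj G X ; adj-sym = cSym G X ; adj-irrefl = cIrr G X }

-- (4) attaching a clique on Fin k, all of whose vertices are joined to
-- the vertex v (given by its indicator isv).
private
  fSym : ∀ {k} (i j : Fin k) → not ⌊ i F.≟ j ⌋ ≡ not ⌊ j F.≟ i ⌋
  fSym i j with i F.≟ j | j F.≟ i
  ... | yes _ | yes _ = refl
  ... | no _  | no _  = refl
  ... | yes p | no q  = Data.Empty.⊥-elim (q (Eq.sym p))
    where import Data.Empty
  ... | no q  | yes p = Data.Empty.⊥-elim (q (Eq.sym p))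
    where import Data.Empty

  fIrr : ∀ {k} (i : Fin k) → not ⌊ i F.≟ i ⌋ ≡ false
  fIrr i with i F.≟ i
  ... | yes _ = refl
  ... | no q = Data.Empty.⊥-elim (q refl)
    where import Data.Empty

  aAdj : (G : Graph) (k : ℕ) → (V G → Bool) → V G ⊎ Fin k → V G ⊎ Fin k → Bool
  aAdj G k isv (inj₁ x) (inj₁ y) = adj G x y
  aAdj G k isv (inj₂ i) (inj₂ j) = not ⌊ i F.≟ j ⌋
  aAdj G k isv (inj₁ x) (inj₂ j) = isv x
  aAdj G k isv (inj₂ i) (inj₁ y) = isv y

  aSym : ∀ G k isv u v → aAdj G k isv u v ≡ aAdj G k isv v u
  aSym G k isv (inj₁ x) (inj₁ y) = adj-sym G x y
  aSym G k isv (inj₂ i) (inj₂ j) = fSym i j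
  aSym G k isv (inj₁ x) (inj₂ j) = refl
  aSym G k isv (inj₂ i) (inj₁ y) = refl

  aIrr : ∀ G k isv v → aAdj G k isv v v ≡ false
  aIrr G k isv (inj₁ x) = adj-irrefl G x
  aIrr G k isv (inj₂ i) = fIrr i

attachClique : (G : Graph) (k : ℕ) → (V G → Bool) → Graph
attachClique G k isv = record { V = V G ⊎ Fin k ; adj = aAdj G k isv ; adj-sym = aSym G k isv ; adj-irrefl = aIrr G k isv }

data OAT : Graph → Set₁ where
  single  : OAT K1
  union   : ∀ {G H} → OAT G → OAT H → OAT (G ⊕ H)
  join    : ∀ {G H} → OAT G → OAT H → OAT (G ⊗ H)
  comparable : ∀ {G} → OAT G → (v : V G) (X : V G → Bool) →
               (∀ x → T (X x) → T (adj G v x)) → OAT (addVertex G X)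
  clique  : ∀ {G} → OAT G → (v : V G) (k : ℕ) (isv : V G → Bool) →
            (∀ x → (T (isv x) → x ≡ v) × (x ≡ v → T (isv x))) →
            OAT (attachClique G k isv)
  iso     : ∀ {G H} → OAT G → G ≅ H → OAT H

module Submission where

-- (⇐) G arises from G ∖ Q by attaching a clique of size |Q| at z, i.e. by
--     operation (4).  `attached-clique` recognises such an attachment inside
--     any graph; |Q| exists since subsets of finite sets are finite.
--
-- (⇒) By induction on OAT derivations (`delete-separated`): if every edge
--     leaving a vertex set Q ends at one fixed vertex, then G ∖ Q is OAT or
--     empty.  Deletion commutes with
--     the four operations and with isomorphism (the `delete-*` lemmas),
--     separation restricts to the constituents (`separates-pullback`), and
--     the pieces are reassembled by the operations; an emptied constituent or
--     a deleted attachment vertex turns into a disjoint union.  A component of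
--     G ∖ z is separated by z, and z survives, so G ∖ Q is OAT.

open import Defs
open import Data.Bool using (Bool; true; false; T; not)
open import Data.Bool.Properties using (T-irrelevant; T-≡; T-not-≡)
open import Data.Empty using (⊥; ⊥-elim)
open import Data.Fin using (Fin; zero; suc)
import Data.Fin as F
open import Data.Fin.Properties using (0↔⊥; 1↔⊤; +↔⊎; suc-injective)
open import Data.Maybe using (Maybe; just; nothing; _>>=_)
open import Data.Maybe.Properties using (just-injective)
open import Data.Nat using (ℕ; zero; suc; _+_)
open import Data.Product using (Σ; _×_; _,_; proj₁; proj₂; ∃; ∃-syntax)
open import Data.Product.Function.Dependent.Propositional using (Σ-↔)
open import Data.Sum using (_⊎_; inj₁; inj₂; [_,_]′)
open import Data.Sum.Function.Propositional using (_⊎-↔_)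
open import Data.Unit using (tt)
open import Function using (_∘_)
open import Function.Bundles using (_⇔_; _↔_; Inverse; Injection; Equivalence; mk↔ₛ′; mk⇔)
open import Function.Properties.Inverse using (↔-refl; ↔-trans; ↔⇒↣)
open import Relation.Binary.Definitions using (DecidableEquality)
open import Relation.Binary.PropositionalEquality using (_≡_; _≢_; refl; sym; trans; cong; subst)
open import Relation.Nullary using (yes; no; ¬_)
open import Relation.Nullary.Decidable using (⌊_⌋)

T-or-T-not : ∀ b → T b ⊎ T (not b)
T-or-T-not true = inj₁ tt
T-or-T-not false = inj₂ tt

T-not-T : ∀ {b} → T b → T (not b) → ⊥
T-not-T {true} _ ()

¬T⇒≡false : ∀ {b} → ¬ T b → b ≡ false
¬T⇒≡false {false} _ = refl
¬T⇒≡false {true} ¬t = ⊥-elim (¬t tt)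

subtype-≡ : ∀ {A : Set} {P : A → Bool} {a b : A} {p : T (P a)} {q : T (P b)} →
            a ≡ b → _≡_ {A = Σ A (λ x → T (P x))} (a , p) (b , q)
subtype-≡ {p = p} {q} refl = cong (_ ,_) (T-irrelevant p q)

distinct⇒T-not : ∀ {A : Set} (_≟_ : DecidableEquality A) {a b : A} → a ≢ b → T (not ⌊ a ≟ b ⌋)
distinct⇒T-not _≟_ {a} {b} a≢b with a ≟ b
... | yes a≡b = a≢b a≡b
... | no _ = tt

clique-adj : (H : Graph) {m : ℕ} (c : Fin m → V H) →
             (∀ i j → i ≢ j → T (adj H (c i) (c j))) →
             ∀ i j → adj H (c i) (c j) ≡ not ⌊ i F.≟ j ⌋
clique-adj H c distinct i j with i F.≟ j
... | yes refl = adj-irrefl H (c i)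
... | no i≢j = Equivalence.to T-≡ (distinct i j i≢j)

finite-↔ : ∀ {A B : Set} → Finite A → A ↔ B → Finite B
finite-↔ (n , e) f = n , ↔-trans e f

finite-⊎ : ∀ {A B : Set} → Finite A → Finite B → Finite (A ⊎ B)
finite-⊎ (m , e) (n , f) = m + n , ↔-trans +↔⊎ (e ⊎-↔ f)

finite-T : ∀ b → Finite (T b)
finite-T true = 1 , 1↔⊤
finite-T false = 0 , 0↔⊥

subset-suc : ∀ {n} (P : Fin (suc n) → Bool) →
             (T (P zero) ⊎ Σ (Fin n) (λ i → T (P (suc i)))) ↔ Σ (Fin (suc n)) (λ i → T (P i))
subset-suc {n} P = mk↔ₛ′ to from to∘from from∘to
  where
  to : T (P zero) ⊎ Σ (Fin n) (λ i → T (P (suc i))) → Σ (Fin (suc n)) (λ i → T (P i))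
  to (inj₁ p) = zero , p
  to (inj₂ (i , p)) = suc i , p
  from : Σ (Fin (suc n)) (λ i → T (P i)) → T (P zero) ⊎ Σ (Fin n) (λ i → T (P (suc i)))
  from (zero , p) = inj₁ p
  from (suc i , p) = inj₂ (i , p)
  to∘from : ∀ x → to (from x) ≡ x
  to∘from (zero , _) = refl
  to∘from (suc _ , _) = refl
  from∘to : ∀ x → from (to x) ≡ x
  from∘to (inj₁ _) = refl
  from∘to (inj₂ _) = refl

finite-subset-Fin : ∀ n (P : Fin n → Bool) → Finite (Σ (Fin n) (λ i → T (P i)))
finite-subset-Fin zero P = 0 , mk↔ₛ′ (λ ()) (λ { (() , _) }) (λ { (() , _) }) (λ ())
finite-subset-Fin (suc n) P =
  finite-↔ (finite-⊎ (finite-T (P zero)) (finite-subset-Fin n (λ i → P (suc i)))) (subset-suc P)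

finite-subset : ∀ {A : Set} → Finite A → (P : A → Bool) → Finite (Σ A (λ a → T (P a)))
finite-subset (n , e) P = finite-↔ (finite-subset-Fin n (λ i → P (Inverse.to e i))) (Σ-↔ e ↔-refl)

-- OAT graphs together with the empty graph; deletions may empty a graph.
OAT₀ : Graph → Set₁
OAT₀ H = OAT H ⊎ (V H → ⊥)

oat₀-iso : ∀ {G H} → OAT₀ G → G ≅ H → OAT₀ H
oat₀-iso (inj₁ o) i = inj₁ (iso o i)
oat₀-iso (inj₂ empty) i = inj₂ (empty ∘ Inverse.from (_≅_.bij i))

oat₀-nonempty : ∀ {H} → OAT₀ H → V H → OAT H
oat₀-nonempty (inj₁ o) _ = o
oat₀-nonempty (inj₂ empty) x = ⊥-elim (empty x)

drop-emptyˡ : ∀ {A B : Set} → (A → ⊥) → B ↔ (A ⊎ B)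
drop-emptyˡ empty = mk↔ₛ′ inj₂ [ ⊥-elim ∘ empty , (λ b → b) ]′
  (λ { (inj₁ a) → ⊥-elim (empty a) ; (inj₂ _) → refl }) (λ _ → refl)

drop-emptyʳ : ∀ {A B : Set} → (B → ⊥) → A ↔ (A ⊎ B)
drop-emptyʳ empty = mk↔ₛ′ inj₁ [ (λ a → a) , ⊥-elim ∘ empty ]′
  (λ { (inj₁ _) → refl ; (inj₂ b) → ⊥-elim (empty b) }) (λ _ → refl)

union₀ : ∀ {A B} → OAT₀ A → OAT₀ B → OAT₀ (A ⊕ B)
union₀ (inj₁ a) (inj₁ b) = inj₁ (union a b)
union₀ (inj₂ emptyA) hB = oat₀-iso hB (record { bij = drop-emptyˡ emptyA ; pres = λ _ _ → refl })
union₀ (inj₁ a) (inj₂ emptyB) = inj₁ (iso a (record { bij = drop-emptyʳ emptyB ; pres = λ _ _ → refl }))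

join₀ : ∀ {A B} → OAT₀ A → OAT₀ B → OAT₀ (A ⊗ B)
join₀ (inj₁ a) (inj₁ b) = inj₁ (join a b)
join₀ (inj₂ emptyA) hB = oat₀-iso hB (record { bij = drop-emptyˡ emptyA ; pres = λ _ _ → refl })
join₀ (inj₁ a) (inj₂ emptyB) = inj₁ (iso a (record { bij = drop-emptyʳ emptyB ; pres = λ _ _ → refl }))

Singles : (D : Graph) → (V D → Bool) → V D → Set
Singles D isv v = ∀ x → (T (isv x) → x ≡ v) × (x ≡ v → T (isv x))

-- After a deletion, an attachment predicate selects one vertex or none.
Attachment : (D : Graph) → (V D → Bool) → Set
Attachment D isv = Σ (V D) (Singles D isv) ⊎ (∀ x → isv x ≡ false)

K : ℕ → Graph
K n = attachClique K1 n (λ _ → true)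

oat-K : ∀ n → OAT (K n)
oat-K n = clique single tt n (λ _ → true) (λ { tt → (λ _ → refl) , (λ _ → tt) })

attach-zero : ∀ D isv → D ≅ attachClique D 0 isv
attach-zero D isv = record { bij = mk↔ₛ′ inj₁ [ (λ d → d) , (λ ()) ]′
                                          (λ { (inj₁ _) → refl ; (inj₂ ()) }) (λ _ → refl)
                           ; pres = λ _ _ → refl }

attach-nowhere : ∀ D n isv → (∀ x → isv x ≡ false) → (D ⊕ K n) ≅ attachClique D (suc n) isv
attach-nowhere D n isv none = record { bij = mk↔ₛ′ to from to∘from from∘to ; pres = pres }
  where
  to : V (D ⊕ K n) → V (attachClique D (suc n) isv)
  to (inj₁ x) = inj₁ x
  to (inj₂ (inj₁ tt)) = inj₂ zero
  to (inj₂ (inj₂ i)) = inj₂ (suc i)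
  from : V (attachClique D (suc n) isv) → V (D ⊕ K n)
  from (inj₁ x) = inj₁ x
  from (inj₂ zero) = inj₂ (inj₁ tt)
  from (inj₂ (suc i)) = inj₂ (inj₂ i)
  to∘from : ∀ y → to (from y) ≡ y
  to∘from (inj₁ _) = refl
  to∘from (inj₂ zero) = refl
  to∘from (inj₂ (suc _)) = refl
  from∘to : ∀ x → from (to x) ≡ x
  from∘to (inj₁ _) = refl
  from∘to (inj₂ (inj₁ tt)) = refl
  from∘to (inj₂ (inj₂ _)) = refl
  clique-part : ∀ i j → adj (attachClique D (suc n) isv) (inj₂ (suc i)) (inj₂ (suc j)) ≡ not ⌊ i F.≟ j ⌋
  clique-part = clique-adj (attachClique D (suc n) isv) (λ i → inj₂ (suc i))
                  (λ i j i≢j → distinct⇒T-not F._≟_ (i≢j ∘ suc-injective))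
  pres : ∀ x y → adj (attachClique D (suc n) isv) (to x) (to y) ≡ adj (D ⊕ K n) x y
  pres (inj₁ _) (inj₁ _) = refl
  pres (inj₁ x) (inj₂ (inj₁ tt)) = none x
  pres (inj₁ x) (inj₂ (inj₂ _)) = none x
  pres (inj₂ (inj₁ tt)) (inj₁ y) = none y
  pres (inj₂ (inj₂ _)) (inj₁ y) = none y
  pres (inj₂ (inj₁ tt)) (inj₂ (inj₁ tt)) = refl
  pres (inj₂ (inj₁ tt)) (inj₂ (inj₂ _)) = refl
  pres (inj₂ (inj₂ _)) (inj₂ (inj₁ tt)) = refl
  pres (inj₂ (inj₂ i)) (inj₂ (inj₂ j)) = clique-part i j

attach₀ : ∀ {D} k isv → OAT₀ D → Attachment D isv → OAT₀ (attachClique D k isv)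
attach₀ k isv (inj₁ o) (inj₁ (v , singles)) = inj₁ (clique o v k isv singles)
attach₀ k isv (inj₂ empty) (inj₁ (v , _)) = ⊥-elim (empty v)
attach₀ {D} zero isv hD (inj₂ _) = oat₀-iso hD (attach-zero D isv)
attach₀ {D} (suc n) isv hD (inj₂ none) = oat₀-iso (union₀ hD (inj₁ (oat-K n))) (attach-nowhere D n isv none)

attach-one : ∀ D X → attachClique D 1 X ≅ addVertex D X
attach-one D X = record { bij = mk↔ₛ′ to from to∘from from∘to ; pres = pres }
  where
  to : V (attachClique D 1 X) → V (addVertex D X)
  to (inj₁ x) = just x
  to (inj₂ zero) = nothing
  from : V (addVertex D X) → V (attachClique D 1 X)
  from (just x) = inj₁ x
  from nothing = inj₂ zero
  to∘from : ∀ y → to (from y) ≡ y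
  to∘from (just _) = refl
  to∘from nothing = refl
  from∘to : ∀ x → from (to x) ≡ x
  from∘to (inj₁ _) = refl
  from∘to (inj₂ zero) = refl
  pres : ∀ x y → adj (addVertex D X) (to x) (to y) ≡ adj (attachClique D 1 X) x y
  pres (inj₁ _) (inj₁ _) = refl
  pres (inj₁ _) (inj₂ zero) = refl
  pres (inj₂ zero) (inj₁ _) = refl
  pres (inj₂ zero) (inj₂ zero) = refl

attached-clique : (H : Graph) (C : V H → Bool) {m : ℕ} (e : Fin m ↔ Σ (V H) (λ c → T (C c)))
                  (isv : V H → Bool) →
                  (∀ a b → T (C a) → T (C b) → a ≢ b → T (adj H a b)) →
                  (∀ d c → T (not (C d)) → T (C c) → adj H d c ≡ isv d) →
                  attachClique (delSet H C) m (λ d → isv (proj₁ d)) ≅ H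
attached-clique H C {m} e isv complete uniform =
  record { bij = mk↔ₛ′ to from to∘from from∘to ; pres = pres }
  where
  open Inverse e using (strictlyInverseˡ; strictlyInverseʳ) renaming (to to enum; from to index)
  A : Graph
  A = attachClique (delSet H C) m (λ d → isv (proj₁ d))
  vertex : Fin m → V H
  vertex i = proj₁ (enum i)
  vertex-injective : ∀ i j → vertex i ≡ vertex j → i ≡ j
  vertex-injective i j eq = Injection.injective (↔⇒↣ e) (subtype-≡ eq)
  to : V A → V H
  to (inj₁ (d , _)) = d
  to (inj₂ i) = vertex i
  from : V H → V A
  from h with T-or-T-not (C h)
  ... | inj₁ c = inj₂ (index (h , c))
  ... | inj₂ ¬c = inj₁ (h , ¬c)
  to∘from : ∀ h → to (from h) ≡ h
  to∘from h with T-or-T-not (C h)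
  ... | inj₁ c = cong proj₁ (strictlyInverseˡ (h , c))
  ... | inj₂ _ = refl
  from∘to : ∀ x → from (to x) ≡ x
  from∘to (inj₁ (d , ¬c)) with T-or-T-not (C d)
  ... | inj₁ c = ⊥-elim (T-not-T c ¬c)
  ... | inj₂ _ = cong inj₁ (subtype-≡ refl)
  from∘to (inj₂ i) with T-or-T-not (C (vertex i))
  ... | inj₁ _ = cong inj₂ (trans (cong index (subtype-≡ refl)) (strictlyInverseʳ i))
  ... | inj₂ ¬c = ⊥-elim (T-not-T (proj₂ (enum i)) ¬c)
  pres : ∀ x y → adj H (to x) (to y) ≡ adj A x y
  pres (inj₁ _) (inj₁ _) = refl
  pres (inj₁ (d , ¬c)) (inj₂ j) = uniform d (vertex j) ¬c (proj₂ (enum j))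
  pres (inj₂ i) (inj₁ (d , ¬c)) = trans (adj-sym H (vertex i) d) (uniform d (vertex i) ¬c (proj₂ (enum i)))
  pres (inj₂ i) (inj₂ j) =
    clique-adj H vertex (λ i j i≢j → complete _ _ (proj₂ (enum i)) (proj₂ (enum j)) (i≢j ∘ vertex-injective i j)) i j

delete-K1 : ∀ Q → OAT₀ (delSet K1 Q)
delete-K1 Q with T-or-T-not (Q tt)
... | inj₁ q = inj₂ λ { (tt , ¬q) → T-not-T q ¬q }
... | inj₂ ¬q = inj₁ (iso single (record { bij = mk↔ₛ′ (λ _ → tt , ¬q) proj₁ (λ _ → subtype-≡ refl) (λ _ → refl)
                                         ; pres = λ _ _ → refl }))

split-deletion : ∀ {A B : Set} (Q : A ⊎ B → Bool) →
                 (Σ A (λ a → T (not (Q (inj₁ a)))) ⊎ Σ B (λ b → T (not (Q (inj₂ b))))) ↔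
                 Σ (A ⊎ B) (λ x → T (not (Q x)))
split-deletion {A} {B} Q = mk↔ₛ′ to from to∘from from∘to
  where
  Kept : Set
  Kept = Σ (A ⊎ B) (λ x → T (not (Q x)))
  KeptOnEachSide : Set
  KeptOnEachSide = Σ A (λ a → T (not (Q (inj₁ a)))) ⊎ Σ B (λ b → T (not (Q (inj₂ b))))
  to : KeptOnEachSide → Kept
  to (inj₁ (a , p)) = inj₁ a , p
  to (inj₂ (b , p)) = inj₂ b , p
  from : Kept → KeptOnEachSide
  from (inj₁ a , p) = inj₁ (a , p)
  from (inj₂ b , p) = inj₂ (b , p)
  to∘from : ∀ x → to (from x) ≡ x
  to∘from (inj₁ _ , _) = refl
  to∘from (inj₂ _ , _) = refl
  from∘to : ∀ x → from (to x) ≡ x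
  from∘to (inj₁ _) = refl
  from∘to (inj₂ _) = refl

delete-⊕ : ∀ A B Q → (delSet A (Q ∘ inj₁) ⊕ delSet B (Q ∘ inj₂)) ≅ delSet (A ⊕ B) Q
delete-⊕ A B Q = record
  { bij = split-deletion Q
  ; pres = λ { (inj₁ _) (inj₁ _) → refl ; (inj₁ _) (inj₂ _) → refl
             ; (inj₂ _) (inj₁ _) → refl ; (inj₂ _) (inj₂ _) → refl } }

delete-⊗ : ∀ A B Q → (delSet A (Q ∘ inj₁) ⊗ delSet B (Q ∘ inj₂)) ≅ delSet (A ⊗ B) Q
delete-⊗ A B Q = record
  { bij = split-deletion Q
  ; pres = λ { (inj₁ _) (inj₁ _) → refl ; (inj₁ _) (inj₂ _) → refl
             ; (inj₂ _) (inj₁ _) → refl ; (inj₂ _) (inj₂ _) → refl } }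

delete-added : ∀ G X Q → T (Q nothing) → delSet G (Q ∘ just) ≅ delSet (addVertex G X) Q
delete-added G X Q q = record { bij = mk↔ₛ′ to from to∘from (λ _ → refl) ; pres = λ _ _ → refl }
  where
  to : V (delSet G (Q ∘ just)) → V (delSet (addVertex G X) Q)
  to (w , p) = just w , p
  from : V (delSet (addVertex G X) Q) → V (delSet G (Q ∘ just))
  from (just w , p) = w , p
  from (nothing , ¬q) = ⊥-elim (T-not-T q ¬q)
  to∘from : ∀ y → to (from y) ≡ y
  to∘from (just _ , _) = refl
  to∘from (nothing , ¬q) = ⊥-elim (T-not-T q ¬q)

delete-kept : ∀ G X Q → T (not (Q nothing)) →
              addVertex (delSet G (Q ∘ just)) (X ∘ proj₁) ≅ delSet (addVertex G X) Q
delete-kept G X Q ¬q = record { bij = mk↔ₛ′ to from to∘from from∘to ; pres = pres }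
  where
  D : Graph
  D = addVertex (delSet G (Q ∘ just)) (X ∘ proj₁)
  to : V D → V (delSet (addVertex G X) Q)
  to nothing = nothing , ¬q
  to (just (w , p)) = just w , p
  from : V (delSet (addVertex G X) Q) → V D
  from (nothing , _) = nothing
  from (just w , p) = just (w , p)
  to∘from : ∀ y → to (from y) ≡ y
  to∘from (nothing , _) = subtype-≡ refl
  to∘from (just _ , _) = refl
  from∘to : ∀ x → from (to x) ≡ x
  from∘to nothing = refl
  from∘to (just _) = refl
  pres : ∀ x y → adj (addVertex G X) (proj₁ (to x)) (proj₁ (to y)) ≡ adj D x y
  pres nothing nothing = refl
  pres nothing (just _) = refl
  pres (just _) nothing = refl
  pres (just _) (just _) = refl

delete-attached : ∀ G k isv Q {m} (e : Fin m ↔ Σ (Fin k) (λ j → T (not (Q (inj₂ j))))) →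
                  attachClique (delSet G (Q ∘ inj₁)) m (isv ∘ proj₁) ≅ delSet (attachClique G k isv) Q
delete-attached G k isv Q {m} e = record { bij = mk↔ₛ′ to from to∘from from∘to ; pres = pres }
  where
  open Inverse e using (strictlyInverseˡ; strictlyInverseʳ) renaming (to to enum; from to index)
  A : Graph
  A = attachClique (delSet G (Q ∘ inj₁)) m (isv ∘ proj₁)
  survivor : Fin m → Fin k
  survivor i = proj₁ (enum i)
  to : V A → V (delSet (attachClique G k isv) Q)
  to (inj₁ (w , p)) = inj₁ w , p
  to (inj₂ i) = inj₂ (survivor i) , proj₂ (enum i)
  from : V (delSet (attachClique G k isv) Q) → V A
  from (inj₁ w , p) = inj₁ (w , p)
  from (inj₂ j , p) = inj₂ (index (j , p))
  to∘from : ∀ y → to (from y) ≡ y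
  to∘from (inj₁ _ , _) = refl
  to∘from (inj₂ j , p) = cong (λ s → inj₂ (proj₁ s) , proj₂ s) (strictlyInverseˡ (j , p))
  from∘to : ∀ x → from (to x) ≡ x
  from∘to (inj₁ _) = refl
  from∘to (inj₂ i) = cong inj₂ (strictlyInverseʳ i)
  survivor-injective : ∀ i j → survivor i ≡ survivor j → i ≡ j
  survivor-injective i j eq = Injection.injective (↔⇒↣ e) (subtype-≡ eq)
  pres : ∀ x y → adj (attachClique G k isv) (proj₁ (to x)) (proj₁ (to y)) ≡ adj A x y
  pres (inj₁ _) (inj₁ _) = refl
  pres (inj₁ _) (inj₂ _) = refl
  pres (inj₂ _) (inj₁ _) = refl
  pres (inj₂ i) (inj₂ j) = clique-adj (attachClique G k isv) (inj₂ ∘ survivor)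
    (λ i j i≢j → distinct⇒T-not F._≟_ (i≢j ∘ survivor-injective i j)) i j

delete-≅ : ∀ {G H} (i : G ≅ H) (Q : V H → Bool) → delSet G (Q ∘ Inverse.to (_≅_.bij i)) ≅ delSet H Q
delete-≅ {G} {H} i Q = record { bij = mk↔ₛ′ to from to∘from from∘to
                              ; pres = λ x y → _≅_.pres i (proj₁ x) (proj₁ y) }
  where
  open Inverse (_≅_.bij i) renaming (to to φ; from to ψ)
  to : V (delSet G (Q ∘ φ)) → V (delSet H Q)
  to (a , p) = φ a , p
  from : V (delSet H Q) → V (delSet G (Q ∘ φ))
  from (b , p) = ψ b , subst (λ y → T (not (Q y))) (sym (strictlyInverseˡ b)) p
  to∘from : ∀ y → to (from y) ≡ y
  to∘from (b , _) = subtype-≡ (strictlyInverseˡ b)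
  from∘to : ∀ x → from (to x) ≡ x
  from∘to (a , _) = subtype-≡ (strictlyInverseʳ a)

Separates : (G : Graph) → Maybe (V G) → (V G → Bool) → Set
Separates G mz Q = ∀ a b → T (Q a) → T (adj G a b) → T (Q b) ⊎ mz ≡ just b

-- An induced embedding of H into G with a partial inverse, along which
-- separation restricts to H.
record Embedding (H G : Graph) : Set where
  field
    map       : V H → V G
    map-adj   : ∀ a b → adj G (map a) (map b) ≡ adj H a b
    unmap     : V G → Maybe (V H)
    unmap-map : ∀ a → unmap (map a) ≡ just a
open Embedding

separates-pullback : ∀ {H G} (f : Embedding H G) {mz Q} → Separates G mz Q →
                     Separates H (mz >>= unmap f) (Q ∘ map f)
separates-pullback f sep a b qa ab with sep (map f a) (map f b) qa (subst T (sym (map-adj f a b)) ab)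
... | inj₁ qb = inj₁ qb
... | inj₂ mz≡b = inj₂ (trans (cong (_>>= unmap f) mz≡b) (unmap-map f b))

unmap-inj₁ : ∀ {A B : Set} → A ⊎ B → Maybe A
unmap-inj₁ = [ just , (λ _ → nothing) ]′

unmap-inj₂ : ∀ {A B : Set} → A ⊎ B → Maybe B
unmap-inj₂ = [ (λ _ → nothing) , just ]′

embed-⊕ˡ : ∀ A B → Embedding A (A ⊕ B)
embed-⊕ˡ A B = record { map = inj₁ ; map-adj = λ _ _ → refl ; unmap = unmap-inj₁ ; unmap-map = λ _ → refl }

embed-⊕ʳ : ∀ A B → Embedding B (A ⊕ B)
embed-⊕ʳ A B = record { map = inj₂ ; map-adj = λ _ _ → refl ; unmap = unmap-inj₂ ; unmap-map = λ _ → refl }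

embed-⊗ˡ : ∀ A B → Embedding A (A ⊗ B)
embed-⊗ˡ A B = record { map = inj₁ ; map-adj = λ _ _ → refl ; unmap = unmap-inj₁ ; unmap-map = λ _ → refl }

embed-⊗ʳ : ∀ A B → Embedding B (A ⊗ B)
embed-⊗ʳ A B = record { map = inj₂ ; map-adj = λ _ _ → refl ; unmap = unmap-inj₂ ; unmap-map = λ _ → refl }

embed-addVertex : ∀ G X → Embedding G (addVertex G X)
embed-addVertex G X = record { map = just ; map-adj = λ _ _ → refl ; unmap = λ x → x ; unmap-map = λ _ → refl }

embed-attach : ∀ G k isv → Embedding G (attachClique G k isv)
embed-attach G k isv = record { map = inj₁ ; map-adj = λ _ _ → refl ; unmap = unmap-inj₁ ; unmap-map = λ _ → refl }

embed-≅ : ∀ {G H} → G ≅ H → Embedding G H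
embed-≅ i = record { map = Inverse.to (_≅_.bij i) ; map-adj = _≅_.pres i
                   ; unmap = just ∘ Inverse.from (_≅_.bij i)
                   ; unmap-map = cong just ∘ Inverse.strictlyInverseʳ (_≅_.bij i) }

attachment-at-most : ∀ D (isv : V D → Bool) mz → (∀ x → T (isv x) → mz ≡ just x) → Attachment D isv
attachment-at-most D isv nothing selected = inj₂ λ x → ¬T⇒≡false λ ix → nothing≢just (selected x ix)
  where
  nothing≢just : ∀ {x : V D} → nothing ≢ just x
  nothing≢just ()
attachment-at-most D isv (just z) selected with T-or-T-not (isv z)
... | inj₁ iz = inj₁ (z , λ x → (λ ix → sym (just-injective (selected x ix))) , λ { refl → iz })
... | inj₂ ¬iz = inj₂ λ x → ¬T⇒≡false λ ix →
                   T-not-T (subst (T ∘ isv) (sym (just-injective (selected x ix))) ix) ¬iz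

restrict-vertex : ∀ {G} (Q : V G → Bool) → V G → Maybe (V (delSet G Q))
restrict-vertex Q x with T-or-T-not (Q x)
... | inj₁ _ = nothing
... | inj₂ ¬qx = just (x , ¬qx)

restrict-vertex-kept : ∀ {G} (Q : V G → Bool) x (¬qx : T (not (Q x))) → restrict-vertex {G} Q x ≡ just (x , ¬qx)
restrict-vertex-kept Q x ¬qx with T-or-T-not (Q x)
... | inj₁ qx = ⊥-elim (T-not-T qx ¬qx)
... | inj₂ _ = cong just (subtype-≡ refl)

separated-neighbours : ∀ {G mz Q} → Separates G mz Q → ∀ a → T (Q a) →
                       (X : V G → Bool) → (∀ x → T (X x) → T (adj G a x)) →
                       Attachment (delSet G Q) (X ∘ proj₁)
separated-neighbours {G} {mz} {Q} sep a qa X hX =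
  attachment-at-most (delSet G Q) (X ∘ proj₁) (mz >>= restrict-vertex {G} Q) selected
  where
  selected : ∀ (x : V (delSet G Q)) → T (X (proj₁ x)) → (mz >>= restrict-vertex {G} Q) ≡ just x
  selected (x , ¬qx) xx with sep a x qa (hX x xx)
  ... | inj₁ qx = ⊥-elim (T-not-T qx ¬qx)
  ... | inj₂ mz≡x = trans (cong (_>>= restrict-vertex {G} Q) mz≡x) (restrict-vertex-kept Q x ¬qx)

singles-kept : ∀ {G isv v} (Q : V G → Bool) → Singles G isv v → (¬qv : T (not (Q v))) →
               Singles (delSet G Q) (isv ∘ proj₁) (v , ¬qv)
singles-kept Q singles ¬qv (x , _) =
  (λ ix → subtype-≡ (proj₁ (singles x) ix)) , λ { refl → proj₂ (singles x) refl }

singles-deleted : ∀ {G isv v} (Q : V G → Bool) → Singles G isv v → T (Q v) →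
                  ∀ (x : V (delSet G Q)) → isv (proj₁ x) ≡ false
singles-deleted Q singles qv (x , ¬qx) =
  ¬T⇒≡false λ ix → T-not-T (subst (T ∘ Q) (sym (proj₁ (singles x) ix)) qv) ¬qx

singles-attachment : ∀ {G isv v} (Q : V G → Bool) → Singles G isv v → Attachment (delSet G Q) (isv ∘ proj₁)
singles-attachment {G} {isv} {v} Q singles with T-or-T-not (Q v)
... | inj₁ qv = inj₂ (singles-deleted {G} {isv} Q singles qv)
... | inj₂ ¬qv = inj₁ ((v , ¬qv) , singles-kept {G} {isv} Q singles ¬qv)

-- If only u survives, its surviving neighbours are
-- neighbours of v outside Q, hence at most the separating vertex, so u becomes
-- a pendant or an isolated vertex.
delete-from-comparable : ∀ {G} (v : V G) (X : V G → Bool) → (∀ x → T (X x) → T (adj G v x)) →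
                         ∀ mz Q → Separates G mz (Q ∘ just) →
                         OAT₀ (delSet G (Q ∘ just)) → OAT₀ (delSet (addVertex G X) Q)
delete-from-comparable {G} v X hX mz Q sep rest with T-or-T-not (Q nothing)
... | inj₁ qu = oat₀-iso rest (delete-added G X Q qu)
... | inj₂ ¬qu = oat₀-iso extended (delete-kept G X Q ¬qu)
  where
  D : Graph
  D = delSet G (Q ∘ just)
  extended : OAT₀ (addVertex D (X ∘ proj₁))
  extended with T-or-T-not (Q (just v))
  ... | inj₂ ¬qv = inj₁ (comparable (oat₀-nonempty rest (v , ¬qv)) (v , ¬qv) (X ∘ proj₁) (hX ∘ proj₁))
  ... | inj₁ qv = oat₀-iso (attach₀ 1 (X ∘ proj₁) rest (separated-neighbours {G} {mz} {Q ∘ just} sep v qv X hX))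
                           (attach-one D (X ∘ proj₁))

-- Deletion from G with a clique attached at v: the surviving clique vertices
-- are attached at v, or form a separate component if v was deleted.
delete-from-attached : ∀ {G} (v : V G) k isv → Singles G isv v → ∀ Q →
                       OAT₀ (delSet G (Q ∘ inj₁)) → OAT₀ (delSet (attachClique G k isv) Q)
delete-from-attached {G} v k isv singles Q rest =
  oat₀-iso (attach₀ (proj₁ survivors) (isv ∘ proj₁) rest (singles-attachment {G} {isv} (Q ∘ inj₁) singles))
           (delete-attached G k isv Q (proj₂ survivors))
  where
  survivors : Finite (Σ (Fin k) (λ j → T (not (Q (inj₂ j)))))
  survivors = finite-subset-Fin k (λ j → not (Q (inj₂ j)))

delete-separated : ∀ {G} → OAT G → ∀ mz Q → Separates G mz Q → OAT₀ (delSet G Q)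
delete-separated single _ Q _ = delete-K1 Q
delete-separated (union {A} {B} oA oB) _ Q sep =
  oat₀-iso (union₀ (delete-separated oA _ _ (separates-pullback (embed-⊕ˡ A B) sep))
                   (delete-separated oB _ _ (separates-pullback (embed-⊕ʳ A B) sep)))
           (delete-⊕ A B Q)
delete-separated (join {A} {B} oA oB) _ Q sep =
  oat₀-iso (join₀ (delete-separated oA _ _ (separates-pullback (embed-⊗ˡ A B) sep))
                  (delete-separated oB _ _ (separates-pullback (embed-⊗ʳ A B) sep)))
           (delete-⊗ A B Q)
delete-separated (comparable {G} o v X hX) mz Q sep =
  delete-from-comparable v X hX _ Q sep′ (delete-separated o _ _ sep′)
  where
  sep′ : Separates G (mz >>= unmap (embed-addVertex G X)) (Q ∘ just)
  sep′ = separates-pullback (embed-addVertex G X) sep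
delete-separated (clique {G} o v k isv singles) _ Q sep =
  delete-from-attached v k isv singles Q
    (delete-separated o _ _ (separates-pullback (embed-attach G k isv) sep))
delete-separated (iso o i) _ Q sep =
  oat₀-iso (delete-separated o _ _ (separates-pullback (embed-≅ i) sep)) (delete-≅ i Q)

closed-separated : (G : Graph) (_≟_ : DecidableEquality (V G)) (z : V G) (Q : V G → Bool) →
                   Q z ≡ false →
                   (∀ (u w : V (delVertex G _≟_ z)) → T (Q (proj₁ u)) →
                      Reach (delVertex G _≟_ z) u w → T (Q (proj₁ w))) →
                   Separates G (just z) Q
closed-separated G _≟_ z Q qz closed a b qa ab with b ≟ z
... | yes refl = inj₂ refl
... | no b≢z = inj₁ (closed (a , distinct⇒T-not _≟_ a≢z) (b , distinct⇒T-not _≟_ b≢z) qa (step here ab))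
  where
  a≢z : a ≢ z
  a≢z refl = subst T qz qa

separated-uniform : (G : Graph) (_≟_ : DecidableEquality (V G)) (z : V G) (Q : V G → Bool) →
                    Separates G (just z) Q → (∀ c → T (Q c) → T (adj G z c)) →
                    ∀ d c → T (not (Q d)) → T (Q c) → adj G d c ≡ ⌊ d ≟ z ⌋
separated-uniform G _≟_ z Q sep zadj d c ¬qd qc with d ≟ z
... | yes refl = Equivalence.to T-≡ (zadj c qc)
... | no d≢z = ¬T⇒≡false λ dc → leaves (sep c d qc (subst T (adj-sym G d c) dc))
  where
  leaves : T (Q d) ⊎ just z ≡ just d → ⊥
  leaves (inj₁ qd) = T-not-T qd ¬qd
  leaves (inj₂ z≡d) = d≢z (sym (just-injective z≡d))

singles-≟ : (G : Graph) (_≟_ : DecidableEquality (V G)) (z : V G) → Singles G (λ d → ⌊ d ≟ z ⌋) z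
singles-≟ G _≟_ z x = only-z , λ { refl → is-z }
  where
  only-z : T ⌊ x ≟ z ⌋ → x ≡ z
  only-z t with x ≟ z
  ... | yes x≡z = x≡z
  is-z : T ⌊ z ≟ z ⌋
  is-z with z ≟ z
  ... | yes _ = tt
  ... | no z≢z = z≢z refl

lemma8 : (G : Graph) → Finite (V G) → (_≟_ : DecidableEquality (V G)) →
         (z : V G) → IsCutVertex G _≟_ z →
         (Q : V G → Bool) → Q z ≡ false →
         (∃[ q ] T (Q q)) →
         (∀ (u w : V (delVertex G _≟_ z)) → T (Q (proj₁ u)) → T (Q (proj₁ w)) →
            Reach (delVertex G _≟_ z) u w) →
         (∀ (u w : V (delVertex G _≟_ z)) → T (Q (proj₁ u)) →
            Reach (delVertex G _≟_ z) u w → T (Q (proj₁ w))) →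
         (∀ u w → T (Q u) → T (Q w) → u ≢ w → T (adj G u w)) →
         (∀ u → T (Q u) → T (adj G z u)) →
         OAT G ⇔ OAT (delSet G Q)
lemma8 G finite _≟_ z _ Q qz _ _ closed complete zadj = mk⇔ forward backward
  where
  separated : Separates G (just z) Q
  separated = closed-separated G _≟_ z Q qz closed
  z-survives : V (delSet G Q)
  z-survives = z , Equivalence.from T-not-≡ qz
  is-z : V G → Bool
  is-z d = ⌊ d ≟ z ⌋
  cliqueQ : Finite (Σ (V G) (λ c → T (Q c)))
  cliqueQ = finite-subset finite Q
  forward : OAT G → OAT (delSet G Q)
  forward o = oat₀-nonempty (delete-separated o (just z) Q separated) z-survives
  backward : OAT (delSet G Q) → OAT G
  backward o =
    iso (clique o z-survives (proj₁ cliqueQ) (is-z ∘ proj₁)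
                (singles-kept {G} {is-z} Q (singles-≟ G _≟_ z) (Equivalence.from T-not-≡ qz)))
        (attached-clique G Q (proj₂ cliqueQ) is-z complete
                         (separated-uniform G _≟_ z Q separated zadj))
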